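{- Let $P$ be a finite nonempty connected $\Gamma$-colored poset satisfying EC and ND, let $m\ge1$, and fix a linear extension $x_1<\dots<x_p$ of $P$ with $a_t=\kappa(x_t)$. Let $I_1\supseteq\cdots\supseteq I_m$ be an $m$-flag of order ideals with corresponding $P$-partition $\psi$, and set $n_t=\psi(x_t)$, so its word is $\mathbf{a}=a_p^{n_p},\dots,a_2^{n_2},a_1^{n_1}$. (a) Let $1\le j\le p$ and suppose that $(X_{a_{j-1}}^{\min})^{n_{j-1}}\cdots(X_{a_1}^{\min})^{n_1}.\{\emptyset,\dots,\emptyset\}=\{J_1,\dots,J_m\}\neq0$ (listed in gravity order, $J_1\le\cdots\le J_m$; for $j=1$ the left side is $\{\emptyset,\dots,\emptyset\}$). Then $(X_{a_j}^{\min})^{n_j}.\{J_1,\dots,J_m\}=\{J_1\cup\{x_j\},\dots,J_{n_j}\cup\{x_j\},J_{n_j+1},\dots,J_m\}$. (b) $(X_{a_p}^{\min})^{n_p}\cdots(X_{a_1}^{\min})^{n_1}.\{\emptyset,\dots,\emptyset\}=\{I_1,\dots,I_m\}$, and hence $\mathbf{a}$ grows well for $m$.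
   Context: $\kappa:P\to\Gamma$ is a surjective coloring by vertices of a finite simple graph. (EC): equal-colored elements are comparable; (ND): elements in a covering relation have different colors. For an order ideal $I$ and color $a$, $X_a.I=\sum I\cup\{x\}$ over minimal elements $x$ of $P-I$ of color $a$ (under EC this is a single ideal or $0$). A $P$-partition bounded by $m$ is an order-reversing $\psi:P\to\{0,\dots,m\}$, corresponding to the $m$-flag $I_k=\{x:\psi(x)\ge k\}$. Gravity order on ideals (depending on the linear extension): $I<J$ if $|I|>|J|$; if $|I|=|J|$, list the elements of each in linear extension order and compare lexicographically, $I<J$ if at the first differing position the element of $I$ comes earlier in the linear extension. An $m$-multiset of ideals is always listed as $\{I_1,\dots,I_m\}$ with $I_1\le\cdots\le I_m$ in gravity order. For such a multiset and $a\in\Gamma$, $X_a^{\min}.\{I_1,\dots,I_m\}=\{I_1,\dots,X_a.I_g,\dots,I_m\}$ where $g$ is the least index with $X_a.I_g\ne0$, and $0$ if there is none. A word $b_k,\dots,b_1$ (sequence of colors, $b_1$ applied first) grows well for $m$ if $X_{b_k}^{\min}\cdots X_{b_1}^{\min}.\{\emptyset,\dots,\emptyset\}\ne0$; $c^q$ in a word denotes $c$ repeated $q$ times. -}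

module Defs where

open import Data.Bool using (Bool; true; false; T; _∧_; _∨_; not; if_then_else_)
open import Data.Nat using (ℕ; zero; suc; _≤_; _<_; _≤ᵇ_; _<ᵇ_; _≡ᵇ_)
open import Data.Fin using (Fin; toℕ; _≟_)
open import Data.Fin.Subset using (Subset; _∪_; ⁅_⁆; ∣_∣)
open import Data.Vec using (lookup; tabulate)
open import Data.List using (List; []; _∷_; filterᵇ; map; replicate; concat; reverse; applyUpTo; take; drop; _++_)
open import Data.List.Base using (allFin)
open import Data.Maybe using (Maybe; just; nothing; _>>=_)
open import Data.Product using (Σ; _×_; _,_)
open import Data.Sum using (_⊎_)
open import Relation.Nullary using (¬_; does)
open import Relation.Binary.PropositionalEquality using (_≡_; _≢_)
open import Relation.Binary.Construct.Closure.ReflexiveTransitive using (Star)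

-- A finite Γ-coloured poset whose underlying set is Fin p, listed
-- along a fixed linear extension x₁ < … < xₚ (xₜ = the Fin element
-- with toℕ = t-1).  Colours are the vertices Fin c of a finite graph Γ.

record ColoredPoset (p c : ℕ) : Set where
  field
    le       : Fin p → Fin p → Bool
    le-refl  : ∀ x → T (le x x)
    le-antisym : ∀ x y → T (le x y) → T (le y x) → x ≡ y
    le-trans : ∀ x y z → T (le x y) → T (le y z) → T (le x z)
    linext   : ∀ x y → T (le x y) → toℕ x ≤ toℕ y
    κ        : Fin p → Fin c
    κ-surj   : ∀ a → Σ (Fin p) λ x → κ x ≡ a

module _ {p c : ℕ} (P : ColoredPoset p c) where
  open ColoredPoset P

  _<P_ : Fin p → Fin p → Set
  x <P y = T (le x y) × x ≢ y

  Comparable : Fin p → Fin p → Set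
  Comparable x y = T (le x y) ⊎ T (le y x)

  Connected : Set
  Connected = ∀ x y → Star Comparable x y

  Covers : Fin p → Fin p → Set
  Covers x y = x <P y × (∀ z → x <P z → ¬ (z <P y))

  EC : Set
  EC = ∀ x y → κ x ≡ κ y → Comparable x y

  ND : Set
  ND = ∀ x y → Covers x y → κ x ≢ κ y

  Ideal : Set
  Ideal = Subset p

  allB : (Fin p → Bool) → List (Fin p) → Bool
  allB f [] = true
  allB f (x ∷ xs) = f x ∧ allB f xs

  isMinOutside : Ideal → Fin p → Bool
  isMinOutside I x =
    not (lookup I x) ∧
    allB (λ y → not (le y x) ∨ does (y ≟ x) ∨ lookup I y) (allFin p)

  minOutsideOfColor : Fin c → Ideal → List (Fin p)
  minOutsideOfColor a I =
    filterᵇ (λ x → isMinOutside I x ∧ does (κ x ≟ a)) (allFin p)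

  -- X_a.I : I ∪ {x} for the (under EC unique) minimal x ∉ I of colour a,
  -- nothing (= 0) if there is none.
  Xa : Fin c → Ideal → Maybe Ideal
  Xa a I with minOutsideOfColor a I
  ... | []    = nothing
  ... | x ∷ [] = just (I ∪ ⁅ x ⁆)
  ... | _ ∷ _ ∷ _ = nothing   -- impossible under EC

  elems : Ideal → List (Fin p)
  elems I = filterᵇ (λ x → lookup I x) (allFin p)

  lexLt : List (Fin p) → List (Fin p) → Bool
  lexLt [] _ = false
  lexLt (_ ∷ _) [] = false
  lexLt (x ∷ xs) (y ∷ ys) =
    if does (x ≟ y) then lexLt xs ys else (toℕ x <ᵇ toℕ y)

  gravLt : Ideal → Ideal → Bool
  gravLt I J =
    if ∣ J ∣ <ᵇ ∣ I ∣ then true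
    else if ∣ I ∣ ≡ᵇ ∣ J ∣ then lexLt (elems I) (elems J)
    else false

  insertG : Ideal → List Ideal → List Ideal
  insertG I [] = I ∷ []
  insertG I (J ∷ Js) = if gravLt J I then J ∷ insertG I Js else I ∷ J ∷ Js

  sortG : List Ideal → List Ideal
  sortG [] = []
  sortG (I ∷ Is) = insertG I (sortG Is)

  replaceFirst : (Ideal → Maybe Ideal) → List Ideal → Maybe (List Ideal)
  replaceFirst f [] = nothing
  replaceFirst f (I ∷ Is) with f I
  ... | just I' = just (I' ∷ Is)
  ... | nothing with replaceFirst f Is
  ...   | just Is' = just (I ∷ Is')
  ...   | nothing  = nothing

  -- X_a^min on a multiset (a list, considered up to permutation;
  -- it is first listed in gravity order I₁ ≤ ⋯ ≤ Iₘ)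
  Xmin : Fin c → List Ideal → Maybe (List Ideal)
  Xmin a M = replaceFirst (Xa a) (sortG M)

  XminPow : Fin c → ℕ → List Ideal → Maybe (List Ideal)
  XminPow a zero M = just M
  XminPow a (suc n) M = XminPow a n M >>= Xmin a

  -- a word b_k,…,b_1 written as the list b_k ∷ … ∷ b_1 ∷ [];
  -- b_1 is applied first
  applyWord : List (Fin c) → List Ideal → Maybe (List Ideal)
  applyWord [] M = just M
  applyWord (b ∷ bs) M = applyWord bs M >>= Xmin b

  emptyMultiset : ℕ → List Ideal
  emptyMultiset m = replicate m (tabulate (λ _ → false))

  GrowsWell : List (Fin c) → ℕ → Set
  GrowsWell w m = applyWord w (emptyMultiset m) ≢ nothing

  IsPPartition : ℕ → (Fin p → ℕ) → Set
  IsPPartition m ψ = (∀ x y → T (le x y) → ψ y ≤ ψ x) × (∀ x → ψ x ≤ m)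

  flagIdeal : (Fin p → ℕ) → ℕ → Ideal
  flagIdeal ψ k = tabulate (λ x → k ≤ᵇ ψ x)

  flagList : ℕ → (Fin p → ℕ) → List Ideal
  flagList m ψ = applyUpTo (λ i → flagIdeal ψ (suc i)) m

  block : (Fin p → ℕ) → Fin p → List (Fin c)
  block ψ t = replicate (ψ t) (κ t)

  wordOf : (Fin p → ℕ) → List (Fin c)
  wordOf ψ = concat (map (block ψ) (reverse (allFin p)))

  wordBefore : (Fin p → ℕ) → Fin p → List (Fin c)
  wordBefore ψ j =
    concat (map (block ψ) (reverse (filterᵇ (λ t → toℕ t <ᵇ toℕ j) (allFin p))))

  addToFirst : Fin p → ℕ → List Ideal → List Ideal
  addToFirst x n J = map (λ I → I ∪ ⁅ x ⁆) (take n J) ++ drop n J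

{-# OPTIONS --safe #-}
-- Write Iₖ⁽ᵗ⁾ for the flag ideal Iₖ = {x : ψ x ≥ k} cut down to x₁,…,xₜ. The blocks a₁^n₁,…,aₜ^nₜ
-- lead from {∅,…,∅} to the descending chain I₁⁽ᵗ⁾ ⊇ ⋯ ⊇ Iₘ⁽ᵗ⁾. A descending chain is already listed in
-- gravity order, so X^min acts on its first member on which X_a is nonzero. For k ≤ n_{t+1} the element
-- x_{t+1} is minimal outside Iₖ⁽ᵗ⁾ (ψ is order-reversing and the order is a linear extension), and by EC
-- it is the only minimal element of its colour. Once it is added no element of that colour is minimal
-- outside: by EC such an element would lie below x_{t+1}, hence inside, or cover x_{t+1}, against ND.
-- So the block a_{t+1}^n_{t+1} adds x_{t+1} to exactly the first n_{t+1} members, giving the chain for t + 1.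

module Submission where

open import Defs
open import Data.Bool using (Bool; true; false; T; not; _∧_; _∨_)
open import Data.Bool.Properties using (T-∧; T-∨; T-≡; T-not-≡)
open import Data.Empty using (⊥-elim)
open import Data.Fin using (Fin; toℕ; fromℕ<; _≟_) renaming (zero to fzero; suc to fsuc)
open import Data.Fin.Properties using (toℕ-injective; toℕ<n; toℕ-fromℕ<)
open import Data.Fin.Subset using (Subset; _∈_; _∉_; _⊆_; _∪_; ⁅_⁆; ∣_∣; inside; outside)
open import Data.Fin.Subset.Properties
  using (drop-∷-⊆; p⊆q⇒∣p∣≤∣q∣; ⊆-antisym; p⊆p∪q; x∈p∪q⁺; x∈p∪q⁻; x∈⁅x⁆; x∈⁅y⁆⇒x≡y)
open import Data.List
  using (List; []; _∷_; _++_; _∷ʳ_; map; concat; reverse; replicate; take; filterᵇ; applyUpTo; allFin; tabulate)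
open import Data.List.Properties
  using (filter-accept; filter-reject; filter-none; map-tabulate; take-map; take-all; take-suc-tabulate;
         length-tabulate; reverse-++)
open import Data.List.Relation.Unary.All as All using (All; []; _∷_)
open import Data.List.Relation.Unary.All.Properties using (tabulate⁺; tabulate⁻)
open import Data.List.Relation.Unary.Any using () renaming (here to hereˡ; there to thereˡ)
open import Data.List.Relation.Unary.Unique.Propositional using (Unique)
open import Data.List.Relation.Unary.AllPairs using (_∷_)
open import Data.List.Relation.Unary.Unique.Propositional.Properties using (allFin⁺)
open import Data.List.Membership.Propositional using () renaming (_∈_ to _∈ˡ_)
open import Data.List.Membership.Propositional.Properties using (∈-allFin)
open import Data.List.Relation.Binary.Permutation.Propositional using (_↭_; ↭-reflexive)
open import Data.Maybe using (Maybe; just; nothing; _>>=_)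
open import Data.Maybe.Properties using (just-injective)
open import Data.Nat using (ℕ; zero; suc; _≤_; _<_; _≤ᵇ_; _<ᵇ_; _≡ᵇ_; z≤n; s≤s; _<?_)
open import Data.Nat.Properties
  using (<ᵇ⇒<; <⇒<ᵇ; ≤ᵇ⇒≤; ≤⇒≤ᵇ; ≡ᵇ⇒≡; ≤∧≢⇒<; <⇒≱; ≤-trans; <⇒≤; ≮⇒≥; n≮n; suc-injective;
         m<1+n⇒m<n∨m≡n; m<n⇒m<1+n; ≤-refl; ≤-reflexive)
open import Data.Product using (Σ; _×_; _,_; proj₁; proj₂)
open import Data.Sum using (inj₁; inj₂; map₁)
open import Data.Vec using (lookup; here) renaming (_∷_ to _∷ᵥ_; [] to []ᵥ; tabulate to tabulateᵥ)
open import Data.Vec.Properties using (lookup∘tabulate; tabulate-cong; []=⇒lookup; lookup⇒[]=)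
open import Function using (_∘_; id)
open import Function.Bundles using (Equivalence)
open import Relation.Nullary using (¬_; Dec; does; yes; no; contradiction; T?)
open import Relation.Nullary.Decidable using (dec-true)
open import Relation.Binary.PropositionalEquality using (_≡_; _≢_; refl; sym; trans; cong; cong₂; subst; module ≡-Reasoning)

filterᵇ-singleton : ∀ {A : Set} (f : A → Bool) {t : A} {xs : List A} → Unique xs → t ∈ˡ xs →
  T (f t) → (∀ y → T (f y) → y ≡ t) → filterᵇ f xs ≡ t ∷ []
filterᵇ-singleton f (t∉xs ∷ _) (hereˡ refl) ft only =
  trans (filter-accept (T? ∘ f) ft)
        (cong (_ ∷_) (filter-none (T? ∘ f) (All.map (λ t≢y fy → t≢y (sym (only _ fy))) t∉xs)))
filterᵇ-singleton f (x∉xs ∷ u) (thereˡ t∈xs) ft only =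
  trans (filter-reject (T? ∘ f) (λ fx → All.lookup x∉xs t∈xs (only _ fx)))
        (filterᵇ-singleton f u t∈xs ft only)

filterᵇ-map : ∀ {A B : Set} (f : A → B) (g : B → Bool) (xs : List A) →
  filterᵇ g (map f xs) ≡ map f (filterᵇ (g ∘ f) xs)
filterᵇ-map f g [] = refl
filterᵇ-map f g (x ∷ xs) with g (f x)
... | true  = cong (f x ∷_) (filterᵇ-map f g xs)
... | false = filterᵇ-map f g xs

filterᵇ-<ᵇ-allFin : ∀ n k → filterᵇ (λ t → toℕ t <ᵇ k) (allFin n) ≡ take k (allFin n)
filterᵇ-<ᵇ-allFin zero    zero    = refl
filterᵇ-<ᵇ-allFin zero    (suc k) = refl
filterᵇ-<ᵇ-allFin (suc n) zero    = filter-none (T? ∘ (λ t → toℕ t <ᵇ 0)) (All.universal (λ _ ()) (allFin (suc n)))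
filterᵇ-<ᵇ-allFin (suc n) (suc k) = cong (fzero ∷_) (begin
    filterᵇ (λ t → toℕ t <ᵇ suc k) (tabulate fsuc)       ≡⟨ cong (filterᵇ _) (sym (map-tabulate id fsuc)) ⟩
    filterᵇ (λ t → toℕ t <ᵇ suc k) (map fsuc (allFin n)) ≡⟨ filterᵇ-map fsuc _ (allFin n) ⟩
    map fsuc (filterᵇ (λ t → toℕ t <ᵇ k) (allFin n))     ≡⟨ cong (map fsuc) (filterᵇ-<ᵇ-allFin n k) ⟩
    map fsuc (take k (allFin n))                         ≡⟨ sym (take-map k (allFin n)) ⟩
    take k (map fsuc (allFin n))                         ≡⟨ cong (take k) (map-tabulate id fsuc) ⟩
    take k (tabulate fsuc)                               ∎)
  where open ≡-Reasoning

take-suc-allFin : ∀ {n k} (k<n : k < n) → take (suc k) (allFin n) ≡ take k (allFin n) ∷ʳ fromℕ< k<n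
take-suc-allFin {n} k<n =
  subst (λ k → take (suc k) (allFin n) ≡ take k (allFin n) ∷ʳ fromℕ< k<n)
        (toℕ-fromℕ< k<n) (take-suc-tabulate id (fromℕ< k<n))

⊆∧∣≡∣⇒≡ : ∀ {n} {p q : Subset n} → p ⊆ q → ∣ p ∣ ≡ ∣ q ∣ → p ≡ q
⊆∧∣≡∣⇒≡ {p = []ᵥ}          {[]ᵥ}          _   _ = refl
⊆∧∣≡∣⇒≡ {p = outside ∷ᵥ p} {outside ∷ᵥ q} p⊆q e = cong (outside ∷ᵥ_) (⊆∧∣≡∣⇒≡ (drop-∷-⊆ p⊆q) e)
⊆∧∣≡∣⇒≡ {p = outside ∷ᵥ p} {inside  ∷ᵥ q} p⊆q e =
  contradiction (subst (_≤ ∣ q ∣) e (p⊆q⇒∣p∣≤∣q∣ (drop-∷-⊆ p⊆q))) (n≮n _)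
⊆∧∣≡∣⇒≡ {p = inside  ∷ᵥ p} {outside ∷ᵥ q} p⊆q e = contradiction (p⊆q here) λ ()
⊆∧∣≡∣⇒≡ {p = inside  ∷ᵥ p} {inside  ∷ᵥ q} p⊆q e =
  cong (inside ∷ᵥ_) (⊆∧∣≡∣⇒≡ (drop-∷-⊆ p⊆q) (suc-injective e))

replicate≡applyUpTo : ∀ {A : Set} (x : A) n → replicate n x ≡ applyUpTo (λ _ → x) n
replicate≡applyUpTo x zero    = refl
replicate≡applyUpTo x (suc n) = cong (x ∷_) (replicate≡applyUpTo x n)

applyUpTo-cong : ∀ {A : Set} {f g : ℕ → A} → (∀ i → f i ≡ g i) → ∀ n → applyUpTo f n ≡ applyUpTo g n
applyUpTo-cong f≗g zero    = refl
applyUpTo-cong f≗g (suc n) = cong₂ _∷_ (f≗g 0) (applyUpTo-cong (f≗g ∘ suc) n)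

T-does⇒ : ∀ {A : Set} (a? : Dec A) → T (does a?) → A
T-does⇒ (yes a) _ = a

T-lookup⇒∈ : ∀ {n} {I : Subset n} {x} → T (lookup I x) → x ∈ I
T-lookup⇒∈ {I = I} {x} h = lookup⇒[]= x I (Equivalence.to T-≡ h)

∈⇒T-lookup : ∀ {n} {I : Subset n} {x} → x ∈ I → T (lookup I x)
∈⇒T-lookup x∈I = Equivalence.from T-≡ ([]=⇒lookup x∈I)

∉⇒T-not-lookup : ∀ {n} {I : Subset n} {x} → x ∉ I → T (not (lookup I x))
∉⇒T-not-lookup {I = I} {x} x∉I with lookup I x in eq
... | true  = contradiction (T-lookup⇒∈ (Equivalence.from T-≡ eq)) x∉I
... | false = _

∈-tabulate⁺ : ∀ {n} {f : Fin n → Bool} {x} → T (f x) → x ∈ tabulateᵥ f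
∈-tabulate⁺ {f = f} {x} fx = T-lookup⇒∈ (subst T (sym (lookup∘tabulate f x)) fx)

∈-tabulate⁻ : ∀ {n} {f : Fin n → Bool} {x} → x ∈ tabulateᵥ f → T (f x)
∈-tabulate⁻ {f = f} {x} x∈ = subst T (lookup∘tabulate f x) (∈⇒T-lookup x∈)

module _ {p c : ℕ} (P : ColoredPoset p c) where
  open ColoredPoset P

  MinimalOutside : Ideal P → Fin p → Set
  MinimalOutside I x = x ∉ I × (∀ y → T (le y x) → y ≢ x → y ∈ I)

  allB⁻ : ∀ {f} xs → T (allB P f xs) → All (T ∘ f) xs
  allB⁻ []       _ = []
  allB⁻ (x ∷ xs) h = proj₁ (Equivalence.to T-∧ h) ∷ allB⁻ xs (proj₂ (Equivalence.to T-∧ h))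

  allB⁺ : ∀ {f} xs → All (T ∘ f) xs → T (allB P f xs)
  allB⁺ []       []       = _
  allB⁺ (x ∷ xs) (fx ∷ h) = Equivalence.from T-∧ (fx , allB⁺ xs h)

  isMinOutside⇒MinimalOutside : ∀ {I x} → T (isMinOutside P I x) → MinimalOutside I x
  isMinOutside⇒MinimalOutside {I} {x} h = x∉I , below
    where
    x∉I : x ∉ I
    x∉I x∈I = subst (T ∘ not) ([]=⇒lookup x∈I) (proj₁ (Equivalence.to T-∧ h))
    below : ∀ y → T (le y x) → y ≢ x → y ∈ I
    below y y≤x y≢x with Equivalence.to T-∨ (tabulate⁻ (allB⁻ _ (proj₂ (Equivalence.to T-∧ h))) y)
    ... | inj₁ y≰x = ⊥-elim (subst T (Equivalence.to T-not-≡ y≰x) y≤x)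
    ... | inj₂ rest with Equivalence.to T-∨ rest
    ...   | inj₁ y≡x = contradiction (T-does⇒ (y ≟ x) y≡x) y≢x
    ...   | inj₂ y∈I = T-lookup⇒∈ y∈I

  MinimalOutside⇒isMinOutside : ∀ {I x} → MinimalOutside I x → T (isMinOutside P I x)
  MinimalOutside⇒isMinOutside {I} {x} (x∉I , below) =
    Equivalence.from T-∧ (∉⇒T-not-lookup x∉I , allB⁺ _ (tabulate⁺ ok))
    where
    ok : ∀ y → T (not (le y x) ∨ does (y ≟ x) ∨ lookup I y)
    ok y with le y x in y≤x | y ≟ x
    ... | false | _       = _
    ... | true  | yes _   = _
    ... | true  | no y≢x  = ∈⇒T-lookup (below y (Equivalence.from T-≡ y≤x) y≢x)

  MinimalOutside-unique : EC P → ∀ {I x y} → κ x ≡ κ y → MinimalOutside I x → MinimalOutside I y → x ≡ y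
  MinimalOutside-unique ec {x = x} {y} κx≡κy (x∉I , below-x) (y∉I , below-y) with x ≟ y
  ... | yes x≡y = x≡y
  ... | no x≢y with ec x y κx≡κy
  ...   | inj₁ x≤y = contradiction (below-y x x≤y x≢y) x∉I
  ...   | inj₂ y≤x = contradiction (below-x y y≤x (x≢y ∘ sym)) y∉I

  Xa-MinimalOutside : EC P → ∀ {I x} → MinimalOutside I x → Xa P (κ x) I ≡ just (I ∪ ⁅ x ⁆)
  Xa-MinimalOutside ec {I} {x} x-min
    with minOutsideOfColor P (κ x) I
       | filterᵇ-singleton _ (allFin⁺ p) (∈-allFin x)
           (Equivalence.from T-∧ (MinimalOutside⇒isMinOutside x-min , Equivalence.from T-≡ (dec-true (κ x ≟ κ x) refl)))
           only
    where
    only : ∀ y → T (isMinOutside P I y ∧ does (κ y ≟ κ x)) → y ≡ x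
    only y h = MinimalOutside-unique ec (T-does⇒ (κ y ≟ κ x) (proj₂ (Equivalence.to T-∧ h)))
                 (isMinOutside⇒MinimalOutside (proj₁ (Equivalence.to T-∧ h))) x-min
  ... | _ | refl = refl

  Xa-noMinimalOutside : ∀ {a I} → (∀ y → κ y ≡ a → ¬ MinimalOutside I y) → Xa P a I ≡ nothing
  Xa-noMinimalOutside {a} {I} none
    with minOutsideOfColor P a I
       | filter-none (T? ∘ (λ y → isMinOutside P I y ∧ does (κ y ≟ a))) (All.universal excluded (allFin p))
    where
    excluded : ∀ y → ¬ T (isMinOutside P I y ∧ does (κ y ≟ a))
    excluded y h = none y (T-does⇒ (κ y ≟ a) (proj₂ (Equivalence.to T-∧ h)))
                     (isMinOutside⇒MinimalOutside (proj₁ (Equivalence.to T-∧ h)))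
  ... | _ | refl = refl

  lexLt-irrefl : ∀ xs → lexLt P xs xs ≡ false
  lexLt-irrefl []       = refl
  lexLt-irrefl (x ∷ xs) with x ≟ x
  ... | yes _   = lexLt-irrefl xs
  ... | no x≢x = contradiction refl x≢x

  gravLt-⊆ : ∀ {I J} → J ⊆ I → gravLt P J I ≡ false
  gravLt-⊆ {I} {J} J⊆I with ∣ I ∣ <ᵇ ∣ J ∣ in lt
  ... | true  = contradiction (p⊆q⇒∣p∣≤∣q∣ J⊆I) (<⇒≱ (<ᵇ⇒< _ _ (Equivalence.from T-≡ lt)))
  ... | false with ∣ J ∣ ≡ᵇ ∣ I ∣ in eq
  ...   | false = refl
  ...   | true rewrite ⊆∧∣≡∣⇒≡ J⊆I (≡ᵇ⇒≡ _ _ (Equivalence.from T-≡ eq)) = lexLt-irrefl (elems P I)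

  Antitone : (ℕ → Ideal P) → Set
  Antitone F = ∀ i → F (suc i) ⊆ F i

  sortG-antitone : ∀ {F} → Antitone F → ∀ m → sortG P (applyUpTo F m) ≡ applyUpTo F m
  sortG-antitone anti zero          = refl
  sortG-antitone anti (suc zero)    = refl
  sortG-antitone anti (suc (suc m))
    rewrite sortG-antitone (anti ∘ suc) (suc m) | gravLt-⊆ (anti 0) = refl

  adjoin : Fin p → ℕ → (ℕ → Ideal P) → ℕ → Ideal P
  adjoin x zero    F         = F
  adjoin x (suc n) F zero    = F 0 ∪ ⁅ x ⁆
  adjoin x (suc n) F (suc i) = adjoin x n (F ∘ suc) i

  adjoin-< : ∀ x {n i} F → i < n → adjoin x n F i ≡ F i ∪ ⁅ x ⁆
  adjoin-< x {suc n} {zero}  F _         = refl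
  adjoin-< x {suc n} {suc i} F (s≤s i<n) = adjoin-< x (F ∘ suc) i<n

  adjoin-≥ : ∀ x {n i} F → n ≤ i → adjoin x n F i ≡ F i
  adjoin-≥ x {zero}  {i}     F _         = refl
  adjoin-≥ x {suc n} {suc i} F (s≤s n≤i) = adjoin-≥ x (F ∘ suc) n≤i

  adjoin-⊆ : ∀ x n F i → adjoin x n F i ⊆ F i ∪ ⁅ x ⁆
  adjoin-⊆ x zero    F i       = p⊆p∪q ⁅ x ⁆
  adjoin-⊆ x (suc n) F zero    = id
  adjoin-⊆ x (suc n) F (suc i) = adjoin-⊆ x n (F ∘ suc) i

  adjoin-antitone : ∀ x n {F} → Antitone F → Antitone (adjoin x n F)
  adjoin-antitone x zero    anti i       = anti i
  adjoin-antitone x (suc n) anti zero y∈ = x∈p∪q⁺ (map₁ (anti 0) (x∈p∪q⁻ _ _ (adjoin-⊆ x n _ 0 y∈)))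
  adjoin-antitone x (suc n) anti (suc i) = adjoin-antitone x n (anti ∘ suc) i

  addToFirst-applyUpTo : ∀ x n F m → addToFirst P x n (applyUpTo F m) ≡ applyUpTo (adjoin x n F) m
  addToFirst-applyUpTo x zero    F m       = refl
  addToFirst-applyUpTo x (suc n) F zero    = refl
  addToFirst-applyUpTo x (suc n) F (suc m) = cong (F 0 ∪ ⁅ x ⁆ ∷_) (addToFirst-applyUpTo x n (F ∘ suc) m)

  replaceFirst-adjoin : ∀ {a x n m} F → n < m →
    (∀ i → i < n → Xa P a (F i ∪ ⁅ x ⁆) ≡ nothing) → Xa P a (F n) ≡ just (F n ∪ ⁅ x ⁆) →
    replaceFirst P (Xa P a) (applyUpTo (adjoin x n F) m) ≡ just (applyUpTo (adjoin x (suc n) F) m)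
  replaceFirst-adjoin {n = zero}  {suc m} F _ _ grows rewrite grows = refl
  replaceFirst-adjoin {n = suc n} {suc m} F (s≤s n<m) stuck grows
    rewrite stuck 0 (s≤s z≤n)
          | replaceFirst-adjoin (F ∘ suc) n<m (λ i i<n → stuck (suc i) (s≤s i<n)) grows = refl

  XminPow-adjoin : ∀ {a x F} n m → Antitone F → n ≤ m →
    (∀ i → i < n → Xa P a (F i) ≡ just (F i ∪ ⁅ x ⁆)) →
    (∀ i → i < n → Xa P a (F i ∪ ⁅ x ⁆) ≡ nothing) →
    XminPow P a n (applyUpTo F m) ≡ just (applyUpTo (adjoin x n F) m)
  XminPow-adjoin zero m anti _ _ _ = refl
  XminPow-adjoin {x = x} {F} (suc n) m anti n<m grows stuck
    rewrite XminPow-adjoin n m anti (<⇒≤ n<m) (λ i → grows i ∘ m<n⇒m<1+n) (λ i → stuck i ∘ m<n⇒m<1+n)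
          | sortG-antitone (adjoin-antitone x n anti) m
    = replaceFirst-adjoin F n<m (λ i → stuck i ∘ m<n⇒m<1+n) (grows n ≤-refl)

  applyWord-++ : ∀ w₁ w₂ {M M′} → applyWord P w₂ M ≡ just M′ → applyWord P (w₁ ++ w₂) M ≡ applyWord P w₁ M′
  applyWord-++ []       w₂ w₂M≡M′ = w₂M≡M′
  applyWord-++ (b ∷ w₁) w₂ w₂M≡M′ = cong (_>>= Xmin P b) (applyWord-++ w₁ w₂ w₂M≡M′)

  applyWord-replicate : ∀ a n M → applyWord P (replicate n a) M ≡ XminPow P a n M
  applyWord-replicate a zero    M = refl
  applyWord-replicate a (suc n) M = cong (_>>= Xmin P a) (applyWord-replicate a n M)

module FlagGrowth {p c : ℕ} (P : ColoredPoset p c) (ec : EC P) (nd : ND P) (m : ℕ) (ψ : Fin p → ℕ)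
  (ψ-reversing : ∀ x y → T (ColoredPoset.le P x y) → ψ y ≤ ψ x) (ψ≤m : ∀ x → ψ x ≤ m) where
  open ColoredPoset P

  flagIdealBefore : ℕ → ℕ → Ideal P
  flagIdealBefore t k = tabulateᵥ (λ x → (toℕ x <ᵇ t) ∧ (k ≤ᵇ ψ x))

  ∈-flagIdealBefore⁺ : ∀ t k {x} → toℕ x < t → k ≤ ψ x → x ∈ flagIdealBefore t k
  ∈-flagIdealBefore⁺ t k x<t k≤ψx = ∈-tabulate⁺ (Equivalence.from T-∧ (<⇒<ᵇ x<t , ≤⇒≤ᵇ k≤ψx))

  ∈-flagIdealBefore⁻ : ∀ t k {x} → x ∈ flagIdealBefore t k → toℕ x < t × k ≤ ψ x
  ∈-flagIdealBefore⁻ t k {x} x∈ with Equivalence.to T-∧ (∈-tabulate⁻ x∈)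
  ... | x<t , k≤ψx = <ᵇ⇒< _ _ x<t , ≤ᵇ⇒≤ k (ψ x) k≤ψx

  flagIdealBefore-antitone : ∀ t → Antitone P (λ i → flagIdealBefore t (suc i))
  flagIdealBefore-antitone t i x∈ with ∈-flagIdealBefore⁻ t (suc (suc i)) x∈
  ... | x<t , i<ψx = ∈-flagIdealBefore⁺ t (suc i) x<t (<⇒≤ i<ψx)

  ∈-flagIdealBefore-below : ∀ t {k y} → k ≤ ψ t → T (le y t) → y ≢ t → y ∈ flagIdealBefore (toℕ t) k
  ∈-flagIdealBefore-below t {k} k≤ψt y≤t y≢t =
    ∈-flagIdealBefore⁺ (toℕ t) k (≤∧≢⇒< (linext _ _ y≤t) (y≢t ∘ toℕ-injective))
                                 (≤-trans k≤ψt (ψ-reversing _ _ y≤t))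

  flagIdealBefore-MinimalOutside : ∀ t {k} → k ≤ ψ t → MinimalOutside P (flagIdealBefore (toℕ t) k) t
  flagIdealBefore-MinimalOutside t {k} k≤ψt =
    (λ t∈ → n≮n _ (proj₁ (∈-flagIdealBefore⁻ (toℕ t) k t∈))) , λ _ → ∈-flagIdealBefore-below t k≤ψt

  flagIdealBefore-∪-noMinimalOutside : ∀ t {k} → k ≤ ψ t →
    ∀ y → κ y ≡ κ t → ¬ MinimalOutside P (flagIdealBefore (toℕ t) k ∪ ⁅ t ⁆) y
  flagIdealBefore-∪-noMinimalOutside t {k} k≤ψt y κy≡κt (y∉ , below-y) with y ≟ t
  ... | yes refl = y∉ (x∈p∪q⁺ (inj₂ (x∈⁅x⁆ t)))
  ... | no y≢t with ec y t κy≡κt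
  ...   | inj₁ y≤t = y∉ (x∈p∪q⁺ (inj₁ (∈-flagIdealBefore-below t k≤ψt y≤t y≢t)))
  ...   | inj₂ t≤y = nd t y ((t≤y , y≢t ∘ sym) , nothing-between) (sym κy≡κt)
    where
    nothing-between : ∀ z → _<P_ P t z → ¬ _<P_ P z y
    nothing-between z (t≤z , t≢z) (z≤y , z≢y) with x∈p∪q⁻ _ _ (below-y z z≤y z≢y)
    ... | inj₁ z∈ = <⇒≱ (proj₁ (∈-flagIdealBefore⁻ (toℕ t) k z∈)) (linext t z t≤z)
    ... | inj₂ z∈⁅t⁆ = t≢z (sym (x∈⁅y⁆⇒x≡y t z∈⁅t⁆))

  flagIdealBefore-suc-⊆ : ∀ t k → flagIdealBefore (suc (toℕ t)) k ⊆ flagIdealBefore (toℕ t) k ∪ ⁅ t ⁆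
  flagIdealBefore-suc-⊆ t k x∈ with ∈-flagIdealBefore⁻ (suc (toℕ t)) k x∈
  ... | x<1+t , k≤ψx with m<1+n⇒m<n∨m≡n x<1+t
  ...   | inj₁ x<t = x∈p∪q⁺ (inj₁ (∈-flagIdealBefore⁺ (toℕ t) k x<t k≤ψx))
  ...   | inj₂ x≡t rewrite toℕ-injective x≡t = x∈p∪q⁺ (inj₂ (x∈⁅x⁆ t))

  flagIdealBefore-⊆-suc : ∀ t k → flagIdealBefore t k ⊆ flagIdealBefore (suc t) k
  flagIdealBefore-⊆-suc t k x∈ with ∈-flagIdealBefore⁻ t k x∈
  ... | x<t , k≤ψx = ∈-flagIdealBefore⁺ (suc t) k (m<n⇒m<1+n x<t) k≤ψx

  flagIdealBefore-extend : ∀ t {k} → k ≤ ψ t →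
    flagIdealBefore (toℕ t) k ∪ ⁅ t ⁆ ≡ flagIdealBefore (suc (toℕ t)) k
  flagIdealBefore-extend t {k} k≤ψt = ⊆-antisym ⊆-suc (flagIdealBefore-suc-⊆ t k)
    where
    ⊆-suc : flagIdealBefore (toℕ t) k ∪ ⁅ t ⁆ ⊆ flagIdealBefore (suc (toℕ t)) k
    ⊆-suc x∈ with x∈p∪q⁻ _ _ x∈
    ... | inj₁ x∈J = flagIdealBefore-⊆-suc (toℕ t) k x∈J
    ... | inj₂ x∈⁅t⁆ rewrite x∈⁅y⁆⇒x≡y t x∈⁅t⁆ = ∈-flagIdealBefore⁺ (suc (toℕ t)) k ≤-refl k≤ψt

  flagIdealBefore-skip : ∀ t {k} → ψ t < k → flagIdealBefore (toℕ t) k ≡ flagIdealBefore (suc (toℕ t)) k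
  flagIdealBefore-skip t {k} ψt<k = ⊆-antisym (flagIdealBefore-⊆-suc (toℕ t) k) ⊆-pre
    where
    ⊆-pre : flagIdealBefore (suc (toℕ t)) k ⊆ flagIdealBefore (toℕ t) k
    ⊆-pre x∈ with x∈p∪q⁻ _ _ (flagIdealBefore-suc-⊆ t k x∈)
    ... | inj₁ x∈J = x∈J
    ... | inj₂ x∈⁅t⁆ rewrite x∈⁅y⁆⇒x≡y t x∈⁅t⁆ =
      contradiction (proj₂ (∈-flagIdealBefore⁻ (suc (toℕ t)) k x∈)) (<⇒≱ ψt<k)

  adjoin-flagIdealBefore : ∀ t i →
    adjoin P t (ψ t) (λ k → flagIdealBefore (toℕ t) (suc k)) i ≡ flagIdealBefore (suc (toℕ t)) (suc i)
  adjoin-flagIdealBefore t i with i <? ψ t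
  ... | yes i<ψt = trans (adjoin-< P t _ i<ψt) (flagIdealBefore-extend t i<ψt)
  ... | no  i≮ψt = trans (adjoin-≥ P t _ (≮⇒≥ i≮ψt)) (flagIdealBefore-skip t (s≤s (≮⇒≥ i≮ψt)))

  flagListBefore : ℕ → List (Ideal P)
  flagListBefore t = applyUpTo (λ i → flagIdealBefore t (suc i)) m

  addToFirst-flagListBefore : ∀ t →
    addToFirst P t (ψ t) (flagListBefore (toℕ t)) ≡ flagListBefore (suc (toℕ t))
  addToFirst-flagListBefore t =
    trans (addToFirst-applyUpTo P t (ψ t) _ m) (applyUpTo-cong (adjoin-flagIdealBefore t) m)

  XminPow-flagListBefore : ∀ t →
    XminPow P (κ t) (ψ t) (flagListBefore (toℕ t)) ≡ just (flagListBefore (suc (toℕ t)))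
  XminPow-flagListBefore t =
    trans (XminPow-adjoin P (ψ t) m (flagIdealBefore-antitone (toℕ t)) (ψ≤m t)
            (λ i i<ψt → Xa-MinimalOutside P ec (flagIdealBefore-MinimalOutside t i<ψt))
            (λ i i<ψt → Xa-noMinimalOutside P (flagIdealBefore-∪-noMinimalOutside t i<ψt)))
          (cong just (applyUpTo-cong (adjoin-flagIdealBefore t) m))

  wordOfList : List (Fin p) → List (Fin c)
  wordOfList xs = concat (map (block P ψ) (reverse xs))

  wordOfList-∷ʳ : ∀ xs t → wordOfList (xs ∷ʳ t) ≡ block P ψ t ++ wordOfList xs
  wordOfList-∷ʳ xs t = cong (concat ∘ map (block P ψ)) (reverse-++ xs (t ∷ []))

  applyWord-take : ∀ k → k ≤ p →
    applyWord P (wordOfList (take k (allFin p))) (emptyMultiset P m) ≡ just (flagListBefore k)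
  applyWord-take zero    _   = cong just (replicate≡applyUpTo _ m)
  applyWord-take (suc k) k<p = begin
    run (take (suc k) (allFin p))                    ≡⟨ cong run (take-suc-allFin k<p) ⟩
    run (take k (allFin p) ∷ʳ t)                     ≡⟨ cong (λ w → applyWord P w _) (wordOfList-∷ʳ (take k (allFin p)) t) ⟩
    applyWord P (block P ψ t ++ wordOfList (take k (allFin p))) _
                                                     ≡⟨ applyWord-++ P (block P ψ t) _ (applyWord-take k (<⇒≤ k<p)) ⟩
    applyWord P (block P ψ t) (flagListBefore k)     ≡⟨ applyWord-replicate P (κ t) (ψ t) _ ⟩
    XminPow P (κ t) (ψ t) (flagListBefore k)         ≡⟨ block-t ⟩
    just (flagListBefore (suc k))                    ∎
    where
    open ≡-Reasoning
    t = fromℕ< k<p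
    run : List (Fin p) → Maybe (List (Ideal P))
    run xs = applyWord P (wordOfList xs) (emptyMultiset P m)
    block-t : XminPow P (κ t) (ψ t) (flagListBefore k) ≡ just (flagListBefore (suc k))
    block-t = subst (λ j → XminPow P (κ t) (ψ t) (flagListBefore j) ≡ just (flagListBefore (suc j)))
                    (toℕ-fromℕ< k<p) (XminPow-flagListBefore t)

  applyWord-wordBefore : ∀ j →
    applyWord P (wordBefore P ψ j) (emptyMultiset P m) ≡ just (flagListBefore (toℕ j))
  applyWord-wordBefore j =
    trans (cong (λ xs → applyWord P (wordOfList xs) (emptyMultiset P m)) (filterᵇ-<ᵇ-allFin p (toℕ j)))
          (applyWord-take (toℕ j) (<⇒≤ (toℕ<n j)))

  applyWord-wordOf : applyWord P (wordOf P ψ) (emptyMultiset P m) ≡ just (flagListBefore p)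
  applyWord-wordOf =
    trans (cong (λ xs → applyWord P (wordOfList xs) (emptyMultiset P m))
                (sym (take-all p (allFin p) (≤-reflexive (length-tabulate id)))))
          (applyWord-take p ≤-refl)

  flagListBefore-all : flagListBefore p ≡ flagList P m ψ
  flagListBefore-all = applyUpTo-cong (λ i → tabulate-cong (λ x → cong (_∧ (suc i ≤ᵇ ψ x)) (x<ᵇp x))) m
    where
    x<ᵇp : ∀ x → (toℕ x <ᵇ p) ≡ true
    x<ᵇp x = Equivalence.to T-≡ (<⇒<ᵇ (toℕ<n x))

  XminPow-wordBefore : (j : Fin p) (L : List (Ideal P)) →
    applyWord P (wordBefore P ψ j) (emptyMultiset P m) ≡ just L →
    Σ (List (Ideal P)) λ K →
      XminPow P (κ j) (ψ j) (sortG P L) ≡ just K × K ↭ addToFirst P j (ψ j) (sortG P L)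
  XminPow-wordBefore j L word≡L with refl ← just-injective (trans (sym word≡L) (applyWord-wordBefore j))
    rewrite sortG-antitone P (flagIdealBefore-antitone (toℕ j)) m =
    flagListBefore (suc (toℕ j)) , XminPow-flagListBefore j , ↭-reflexive (sym (addToFirst-flagListBefore j))

lemma4p3 : (p c : ℕ) (P : ColoredPoset p c) → 1 ≤ p → Connected P → EC P → ND P →
    (m : ℕ) → 1 ≤ m → (ψ : Fin p → ℕ) → IsPPartition P m ψ →
    -- (a)
    ((j : Fin p) (L : List (Ideal P)) →
      applyWord P (wordBefore P ψ j) (emptyMultiset P m) ≡ just L →
      Σ (List (Ideal P)) λ K →
        XminPow P (ColoredPoset.κ P j) (ψ j) (sortG P L) ≡ just K
        × K ↭ addToFirst P j (ψ j) (sortG P L))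
    ×
    -- (b)
    ((Σ (List (Ideal P)) λ K →
        applyWord P (wordOf P ψ) (emptyMultiset P m) ≡ just K
        × K ↭ flagList P m ψ)
     × GrowsWell P (wordOf P ψ) m)
lemma4p3 p c P _ _ ec nd m _ ψ (ψ-reversing , ψ≤m) =
  XminPow-wordBefore ,
  ( (flagListBefore p , applyWord-wordOf , ↭-reflexive flagListBefore-all)
  , (λ ()) ∘ trans (sym applyWord-wordOf))
  where open FlagGrowth P ec nd m ψ ψ-reversing ψ≤m
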